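{- For all integers $a\ge0$, $m\ge2$ and $n\ge2$, \[ \sum_{k=2}^m c_{mk}\binom{a+k}{k}^{ -1}\binom{n+a+k-2}{k-2}=\frac{1}{n(n-1)}\binom{n+a}{a}^{ -1}\sum_{k=2}^m k!\genfrac{\{}{\}}{0pt}{}{m}{k}\binom{n+a}{a+k}. \]
   Context: $\genfrac{\{}{\}}{0pt}{}{m}{k}$ denotes the Stirling number of the second kind. For an integer $k\ge 2$, $\psi_k$ is the polynomial in $n$ defined by $\psi_k(n)=n+(k-1)(n-1)\binom{n+k-2}{k-1}=n+\frac{(n-1)n(n+1)\cdots(n+k-2)}{(k-2)!}$. For $m\ge2$, the rational numbers $c_{mk}$, $2\le k\le m$, are the unique coefficients such that $n^m=\sum_{k=2}^m c_{mk}\psi_k(n)$ as polynomials in $n$. -}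

module Defs where

open import Data.Nat as ℕ using (ℕ; zero; suc; _∸_)
open import Data.Nat.Combinatorics using (_C_)
open import Data.Integer as ℤ using (ℤ; +_)
open import Data.Rational as ℚ using (ℚ; _/_)

⟦_⟧ : ℕ → ℚ
⟦ n ⟧ = + n / 1

-- p / q as a rational; all denominators used below are positive,
-- the value at q = 0 is an irrelevant convention (never used).
frac : ℕ → ℕ → ℚ
frac p zero    = ℚ.0ℚ
frac p (suc q) = + p / suc q

-- Σ_{k=lo}^{hi} f k  (empty sum = 0 when hi < lo)
sumFromTo : ℕ → ℕ → (ℕ → ℚ) → ℚ
sumFromTo lo hi f = go (suc hi ∸ lo)
  where
  go : ℕ → ℚ
  go zero    = ℚ.0ℚ
  go (suc j) = go j ℚ.+ f (lo ℕ.+ j)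

stirling2 : ℕ → ℕ → ℕ
stirling2 zero    zero    = 1
stirling2 zero    (suc k) = 0
stirling2 (suc m) zero    = 0
stirling2 (suc m) (suc k) = suc k ℕ.* stirling2 m (suc k) ℕ.+ stirling2 m k

ψ : ℕ → ℕ → ℚ
ψ k n = ⟦ n ⟧ ℚ.+ (⟦ k ∸ 1 ⟧ ℚ.* (⟦ n ⟧ ℚ.- ℚ.1ℚ)) ℚ.* ⟦ (n ℕ.+ k ∸ 2) C (k ∸ 1) ⟧

-- Multiplying the k-th summand on the left by n(n-1)·C(n+a,a) turns it into
-- c_k·k(k-1)·C(n+a+k-2, a+k), a factorial computation.  Summed over k, this and the
-- Stirling side Σ_k k!·S(m,k)·C(n+a, a+k) both satisfy Pascal's recurrence
-- F(n+1,a+1) = F(n+1,a) + F(n,a+1), both vanish at n = 0, and at a = 0 both equal x^m - x: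
-- the first because ψ_k(x) = x + k(k-1)·C(x+k-2, k) and Σ_k c_k = 1 (take x = 1), the
-- second by x^m = Σ_k k!·S(m,k)·C(x,k).  Hence they agree everywhere.
module Submission where

open import Defs
open import Data.Nat.Base
  using (ℕ; zero; suc; _!; _≤_; _<_; _>_; _^_; _∸_; _+_; _*_; _/_; z≤n; s≤s; z<s)
open import Data.Nat.Properties
open import Data.Nat.Combinatorics
  using (_C_; nCk+nC[k+1]≡[n+1]C[k+1]; k>n⇒nCk≡0; nC1≡n; nCk≡n!/k![n-k]!; k![n∸k]!∣n!)
open import Data.Nat.DivMod using (m/n*n≡m)
open import Data.Nat.Tactic.RingSolver using (solve-∀; solve)
open import Data.List.Base using (_∷_; [])
import Data.Integer.Base as ℤ
import Data.Integer.Properties as ℤP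
open import Data.Rational.Base using (ℚ; 0ℚ; 1ℚ; toℚᵘ; _-_) renaming (_+_ to _+ℚ_; _*_ to _*ℚ_)
import Data.Rational.Properties as ℚ
open import Data.Rational.Unnormalised.Base using (mkℚᵘ; *≡*) renaming (_≃_ to _≃ᵘ_)
import Data.Rational.Unnormalised.Properties as ℚᵘ
open import Relation.Binary.PropositionalEquality using (_≡_; refl; sym; trans; cong; cong₂; subst; module ≡-Reasoning)
open ≡-Reasoning
open import Algebra.Bundles using (CommutativeMonoid)
import Algebra.Properties.CommutativeSemigroup as CommSemigroupProperties
import Algebra.Properties.AbelianGroup as AbelianGroupProperties

private module ℕ+ = CommSemigroupProperties +-commutativeSemigroup
private module ℚ+ = CommSemigroupProperties (CommutativeMonoid.commutativeSemigroup ℚ.+-0-commutativeMonoid)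
private module ℕ* = CommSemigroupProperties *-commutativeSemigroup
private module ℚ+⁻ = AbelianGroupProperties ℚ.+-0-abelianGroup
private module ℚ* = CommSemigroupProperties (CommutativeMonoid.commutativeSemigroup ℚ.*-1-commutativeMonoid)

k≤n⇒nCk>0 : ∀ {n k} → k ≤ n → n C k > 0
k≤n⇒nCk>0 {k = zero} _ = z<s
k≤n⇒nCk>0 {suc n} {suc k} (s≤s k≤n) =
  subst (_> 0) (nCk+nC[k+1]≡[n+1]C[k+1] n k) (<-≤-trans (k≤n⇒nCk>0 k≤n) (m≤m+n _ _))

nCk*[k!*m!]≡n! : ∀ {n} k m → k + m ≡ n → (n C k) * (k ! * m !) ≡ n !
nCk*[k!*m!]≡n! k m refl = begin
  ((k + m) C k) * (k ! * m !)  ≡⟨ cong (λ i → ((k + m) C k) * (k ! * i !)) (m+n∸m≡n k m) ⟨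
  ((k + m) C k) * d            ≡⟨ cong (_* d) (nCk≡n!/k![n-k]! (m≤m+n k m)) ⟩
  (k + m) ! / d * d            ≡⟨ m/n*n≡m (k![n∸k]!∣n! (m≤m+n k m)) ⟩
  (k + m) !                    ∎
  where
  d = k ! * (k + m ∸ k) !
  instance _ = m*n≢0 (k !) ((k + m ∸ k) !) {{k !≢0}} {{(k + m ∸ k) !≢0}}

[1+k]*nC[1+k]+k*nCk≡n*nCk : ∀ n k → suc k * (n C suc k) + k * (n C k) ≡ n * (n C k)
[1+k]*nC[1+k]+k*nCk≡n*nCk zero    zero    = refl
[1+k]*nC[1+k]+k*nCk≡n*nCk zero    (suc k) = cong₂ _+_ (*-zeroʳ (2 + k)) (*-zeroʳ (1 + k))
[1+k]*nC[1+k]+k*nCk≡n*nCk (suc n) zero    = begin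
  1 * (suc n C 1) + 0  ≡⟨ +-identityʳ _ ⟩
  1 * (suc n C 1)      ≡⟨ *-identityˡ _ ⟩
  suc n C 1            ≡⟨ nC1≡n (suc n) ⟩
  suc n                ≡⟨ *-identityʳ (suc n) ⟨
  suc n * 1            ∎
[1+k]*nC[1+k]+k*nCk≡n*nCk (suc n) (suc k) = begin
  (2 + k) * (suc n C (2 + k)) + suc k * (suc n C suc k)
    ≡⟨ cong₂ (λ u v → (2 + k) * u + suc k * v) (pascal (suc k)) (pascal k) ⟩
  (2 + k) * (b₁ + b₂) + suc k * (b₀ + b₁)
    ≡⟨ regroup k b₀ b₁ b₂ ⟩
  ((2 + k) * b₂ + suc k * b₁) + (suc k * b₁ + k * b₀) + (b₀ + b₁)
    ≡⟨ cong₂ (λ u v → u + v + (b₀ + b₁)) ([1+k]*nC[1+k]+k*nCk≡n*nCk n (suc k)) ([1+k]*nC[1+k]+k*nCk≡n*nCk n k) ⟩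
  n * b₁ + n * b₀ + (b₀ + b₁)
    ≡⟨ collect n b₀ b₁ ⟩
  suc n * (b₀ + b₁)
    ≡⟨ cong (suc n *_) (pascal k) ⟨
  suc n * (suc n C suc k) ∎
  where
  b₀ = n C k
  b₁ = n C suc k
  b₂ = n C (2 + k)
  pascal : ∀ i → suc n C suc i ≡ (n C i) + (n C suc i)
  pascal i = sym (nCk+nC[k+1]≡[n+1]C[k+1] n i)
  regroup : ∀ k x y z → (2 + k) * (y + z) + suc k * (x + y) ≡ ((2 + k) * z + suc k * y) + (suc k * y + k * x) + (x + y)
  regroup = solve-∀
  collect : ∀ n x y → n * y + n * x + (x + y) ≡ suc n * (x + y)
  collect = solve-∀

n*[n+k]Ck≡[1+k]*[n+k]C[1+k] : ∀ n k → n * ((n + k) C k) ≡ suc k * ((n + k) C suc k)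
n*[n+k]Ck≡[1+k]*[n+k]C[1+k] n k = +-cancelʳ-≡ (k * ((n + k) C k)) _ _ (begin
  n * ((n + k) C k) + k * ((n + k) C k)  ≡⟨ *-distribʳ-+ ((n + k) C k) n k ⟨
  (n + k) * ((n + k) C k)                ≡⟨ [1+k]*nC[1+k]+k*nCk≡n*nCk (n + k) k ⟨
  suc k * ((n + k) C suc k) + k * ((n + k) C k) ∎)

binomial-identity : ∀ N a j →
  ((N + a + (2 + j)) C j) * ((2 + N) * (1 + N) * ((2 + N + a) C a))
    ≡ (2 + j) * (1 + j) * ((j + (2 + N) + a) C (a + (2 + j))) * ((a + (2 + j)) C (2 + j))
-- Both sides are (N + a + j + 2)! / (j! · a! · N!).
binomial-identity N a j = *-cancelʳ-≡ _ _ (j ! * (a ! * N !)) (trans lhs (sym rhs))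
  where
  instance _ = m*n≢0 (j !) (a ! * N !) {{j !≢0}} {{m*n≢0 (a !) (N !) {{a !≢0}} {{N !≢0}}}}
  lhs : ((N + a + (2 + j)) C j) * ((2 + N) * (1 + N) * ((2 + N + a) C a)) * (j ! * (a ! * N !)) ≡ (N + a + (2 + j)) !
  lhs = begin
    ((N + a + (2 + j)) C j) * ((2 + N) * (1 + N) * ((2 + N + a) C a)) * (j ! * (a ! * N !))
      ≡⟨ regroup ((N + a + (2 + j)) C j) ((2 + N + a) C a) (j !) (a !) (N !) N ⟩
    ((N + a + (2 + j)) C j) * (j ! * (((2 + N + a) C a) * (a ! * (2 + N) !)))
      ≡⟨ cong (λ t → ((N + a + (2 + j)) C j) * (j ! * t)) (nCk*[k!*m!]≡n! a (2 + N) (+-comm a (2 + N))) ⟩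
    ((N + a + (2 + j)) C j) * (j ! * (2 + N + a) !)
      ≡⟨ nCk*[k!*m!]≡n! j (2 + N + a) (solve (N ∷ a ∷ j ∷ [])) ⟩
    (N + a + (2 + j)) ! ∎
    where
    regroup : ∀ x y z u v w → x * ((2 + w) * (1 + w) * y) * (z * (u * v)) ≡ x * (z * (y * (u * ((2 + w) * ((1 + w) * v)))))
    regroup = solve-∀
  rhs : (2 + j) * (1 + j) * ((j + (2 + N) + a) C (a + (2 + j))) * ((a + (2 + j)) C (2 + j)) * (j ! * (a ! * N !)) ≡ (N + a + (2 + j)) !
  rhs = begin
    (2 + j) * (1 + j) * ((j + (2 + N) + a) C (a + (2 + j))) * ((a + (2 + j)) C (2 + j)) * (j ! * (a ! * N !))
      ≡⟨ regroup j ((j + (2 + N) + a) C (a + (2 + j))) ((a + (2 + j)) C (2 + j)) (a !) (N !) (j !) ⟩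
    ((j + (2 + N) + a) C (a + (2 + j))) * (((a + (2 + j)) C (2 + j)) * ((2 + j) ! * a !) * N !)
      ≡⟨ cong (λ t → ((j + (2 + N) + a) C (a + (2 + j))) * (t * N !)) (nCk*[k!*m!]≡n! (2 + j) a (+-comm (2 + j) a)) ⟩
    ((j + (2 + N) + a) C (a + (2 + j))) * ((a + (2 + j)) ! * N !)
      ≡⟨ nCk*[k!*m!]≡n! (a + (2 + j)) N (solve (N ∷ a ∷ j ∷ [])) ⟩
    (j + (2 + N) + a) !
      ≡⟨ cong _! top ⟩
    (N + a + (2 + j)) ! ∎
    where
    top : j + (2 + N) + a ≡ N + a + (2 + j)
    top = solve (N ∷ a ∷ j ∷ [])
    regroup : ∀ j x y u v w → (2 + j) * (1 + j) * x * y * (w * (u * v)) ≡ x * (y * ((2 + j) * ((1 + j) * w) * u) * v)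
    regroup = solve-∀

k>m⇒S[m,k]≡0 : ∀ {m k} → k > m → stirling2 m k ≡ 0
k>m⇒S[m,k]≡0 {zero}  {suc k} _         = refl
k>m⇒S[m,k]≡0 {suc m} {suc k} (s≤s k>m) =
  trans (cong₂ (λ u v → suc k * u + v) (k>m⇒S[m,k]≡0 (m<n⇒m<1+n k>m)) (k>m⇒S[m,k]≡0 k>m))
        (cong (_+ 0) (*-zeroʳ (suc k)))

S[1+m,1]≡1 : ∀ m → stirling2 (suc m) 1 ≡ 1
S[1+m,1]≡1 zero    = refl
S[1+m,1]≡1 (suc m) = trans (+-identityʳ _) (trans (*-identityˡ _) (S[1+m,1]≡1 m))

∑< : ℕ → (ℕ → ℕ) → ℕ
∑< zero    f = 0
∑< (suc n) f = ∑< n f + f n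

∑<-cong : ∀ n {f g : ℕ → ℕ} → (∀ k → f k ≡ g k) → ∑< n f ≡ ∑< n g
∑<-cong zero    f≗g = refl
∑<-cong (suc n) f≗g = cong₂ _+_ (∑<-cong n f≗g) (f≗g n)

∑<-+ : ∀ n (f g : ℕ → ℕ) → ∑< n (λ k → f k + g k) ≡ ∑< n f + ∑< n g
∑<-+ zero    f g = refl
∑<-+ (suc n) f g = trans (cong (_+ (f n + g n)) (∑<-+ n f g)) (ℕ+.interchange (∑< n f) (∑< n g) (f n) (g n))

∑<-*ˡ : ∀ n x (f : ℕ → ℕ) → ∑< n (λ k → x * f k) ≡ x * ∑< n f
∑<-*ˡ zero    x f = sym (*-zeroʳ x)
∑<-*ˡ (suc n) x f = trans (cong (_+ x * f n) (∑<-*ˡ n x f)) (sym (*-distribˡ-+ x (∑< n f) (f n)))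

∑<-suc : ∀ n (f : ℕ → ℕ) → ∑< (suc n) f ≡ f 0 + ∑< n (λ k → f (suc k))
∑<-suc zero    f = +-comm 0 (f 0)
∑<-suc (suc n) f = trans (cong (_+ f (suc n)) (∑<-suc n f)) (+-assoc (f 0) _ _)

∑<-shift : ∀ n (f : ℕ → ℕ) → f 0 ≡ 0 → f n ≡ 0 → ∑< n (λ k → f (suc k)) ≡ ∑< n f
∑<-shift n f f0≡0 fn≡0 = begin
  ∑< n (λ k → f (suc k))        ≡⟨ cong (_+ ∑< n (λ k → f (suc k))) f0≡0 ⟨
  f 0 + ∑< n (λ k → f (suc k))  ≡⟨ ∑<-suc n f ⟨
  ∑< n f + f n                  ≡⟨ cong (∑< n f +_) fn≡0 ⟩
  ∑< n f + 0                    ≡⟨ +-identityʳ (∑< n f) ⟩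
  ∑< n f                        ∎

stirling-expansion : ∀ m x → ∑< (suc m) (λ k → k ! * stirling2 m k * (x C k)) ≡ x ^ m
stirling-expansion zero    x = refl
stirling-expansion (suc m) x = begin
  ∑< (2 + m) (λ k → k ! * stirling2 (suc m) k * (x C k))
    ≡⟨ ∑<-suc (suc m) (λ k → k ! * stirling2 (suc m) k * (x C k)) ⟩
  ∑< (suc m) (λ i → suc i ! * stirling2 (suc m) (suc i) * (x C suc i))
    ≡⟨ ∑<-cong (suc m) recurrence ⟩
  ∑< (suc m) (λ i → suc i * A (suc i) + B i)
    ≡⟨ ∑<-+ (suc m) (λ i → suc i * A (suc i)) B ⟩
  ∑< (suc m) (λ i → suc i * A (suc i)) + ∑< (suc m) B
    ≡⟨ cong (_+ ∑< (suc m) B) (∑<-shift (suc m) (λ i → i * A i) refl top-vanishes) ⟩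
  ∑< (suc m) (λ i → i * A i) + ∑< (suc m) B
    ≡⟨ ∑<-+ (suc m) (λ i → i * A i) B ⟨
  ∑< (suc m) (λ i → i * A i + B i)
    ≡⟨ ∑<-cong (suc m) absorb ⟩
  ∑< (suc m) (λ i → x * A i)
    ≡⟨ ∑<-*ˡ (suc m) x A ⟩
  x * ∑< (suc m) A
    ≡⟨ cong (x *_) (stirling-expansion m x) ⟩
  x * x ^ m ∎
  where
  A B : ℕ → ℕ
  A i = i ! * stirling2 m i * (x C i)
  B i = i ! * stirling2 m i * (suc i * (x C suc i))

  recurrence : ∀ i → suc i ! * stirling2 (suc m) (suc i) * (x C suc i) ≡ suc i * A (suc i) + B i
  recurrence i = distribute i (i !) (stirling2 m (suc i)) (stirling2 m i) (x C suc i)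
    where
    distribute : ∀ i f s t b → suc i * f * (suc i * s + t) * b ≡ suc i * (suc i * f * s * b) + f * t * (suc i * b)
    distribute = solve-∀

  top-vanishes : suc m * A (suc m) ≡ 0
  top-vanishes = trans (cong (λ s → suc m * (suc m ! * s * (x C suc m))) (k>m⇒S[m,k]≡0 (n<1+n m)))
                       (annihilate (suc m) (suc m !) (x C suc m))
    where
    annihilate : ∀ a b c → a * (b * 0 * c) ≡ 0
    annihilate = solve-∀

  absorb : ∀ i → i * A i + B i ≡ x * A i
  absorb i = begin
    i * A i + B i                                  ≡⟨ factor i (i !) (stirling2 m i) (x C i) (suc i * (x C suc i)) ⟩
    i ! * stirling2 m i * (suc i * (x C suc i) + i * (x C i))
      ≡⟨ cong (i ! * stirling2 m i *_) ([1+k]*nC[1+k]+k*nCk≡n*nCk x i) ⟩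
    i ! * stirling2 m i * (x * (x C i))            ≡⟨ swap x (i !) (stirling2 m i) (x C i) ⟩
    x * A i                                        ∎
    where
    factor : ∀ i f s c d → i * (f * s * c) + f * s * d ≡ f * s * (d + i * c)
    factor = solve-∀
    swap : ∀ x f s c → f * s * (x * c) ≡ x * (f * s * c)
    swap = solve-∀

module _ {A : Set} (_∙_ : A → A → A) where

  Pascal : (ℕ → ℕ → A) → Set
  Pascal F = ∀ n a → F (suc n) (suc a) ≡ F (suc n) a ∙ F n (suc a)

  Pascal-unique : ∀ {F G} → Pascal F → Pascal G →
                  (∀ a → F 0 a ≡ G 0 a) → (∀ n → F (suc n) 0 ≡ G (suc n) 0) →
                  ∀ n a → F n a ≡ G n a
  Pascal-unique {F} {G} F-rec G-rec F≡G₀ F≡G₁ = go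
    where
    go : ∀ n a → F n a ≡ G n a
    go zero    a       = F≡G₀ a
    go (suc n) zero    = F≡G₁ n
    go (suc n) (suc a) = begin
      F (suc n) (suc a)          ≡⟨ F-rec n a ⟩
      F (suc n) a ∙ F n (suc a)  ≡⟨ cong₂ _∙_ (go (suc n) a) (go n (suc a)) ⟩
      G (suc n) a ∙ G n (suc a)  ≡⟨ G-rec n a ⟨
      G (suc n) (suc a)          ∎

-- The offset d is added on the left so that d = 0 gives n + a on the nose.
binomial-Pascal : ∀ d e → Pascal _+_ (λ n a → (d + n + a) C (a + e))
binomial-Pascal d e n a = begin
  (d + suc n + suc a) C suc (a + e)
    ≡⟨ cong (_C suc (a + e)) (+-suc (d + suc n) a) ⟩
  suc (d + suc n + a) C suc (a + e)
    ≡⟨ nCk+nC[k+1]≡[n+1]C[k+1] (d + suc n + a) (a + e) ⟨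
  ((d + suc n + a) C (a + e)) + ((d + suc n + a) C suc (a + e))
    ≡⟨ cong (λ t → ((d + suc n + a) C (a + e)) + (t C suc (a + e))) shift ⟩
  ((d + suc n + a) C (a + e)) + ((d + n + suc a) C suc (a + e)) ∎
  where
  shift : d + suc n + a ≡ d + n + suc a
  shift = trans (cong (_+ a) (+-suc d n)) (sym (+-suc (d + n) a))

toℚᵘ-frac : ∀ p q → toℚᵘ (frac p (suc q)) ≃ᵘ mkℚᵘ (ℤ.+ p) q
toℚᵘ-frac p q = ℚ.toℚᵘ-fromℚᵘ (mkℚᵘ (ℤ.+ p) q)

frac-cross : ∀ p q r s → q > 0 → s > 0 → p * s ≡ r * q → frac p q ≡ frac r s
frac-cross p (suc q) r (suc s) z<s z<s ps≡rq = ℚ.toℚᵘ-injective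
  (ℚᵘ.≃-trans (toℚᵘ-frac p q) (ℚᵘ.≃-trans (*≡* cross) (ℚᵘ.≃-sym (toℚᵘ-frac r s))))
  where
  cross : ℤ.+ p ℤ.* ℤ.+ suc s ≡ ℤ.+ r ℤ.* ℤ.+ suc q
  cross = trans (sym (ℤP.pos-* p (suc s))) (trans (cong ℤ.+_ ps≡rq) (ℤP.pos-* r (suc q)))

frac-* : ∀ p q r s → q > 0 → s > 0 → frac p q *ℚ frac r s ≡ frac (p * r) (q * s)
frac-* p (suc q) r (suc s) z<s z<s = ℚ.toℚᵘ-injective
  (ℚᵘ.≃-trans (ℚ.toℚᵘ-homo-* (frac p (suc q)) (frac r (suc s)))
  (ℚᵘ.≃-trans (ℚᵘ.*-cong (toℚᵘ-frac p q) (toℚᵘ-frac r s))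
  (ℚᵘ.≃-trans (ℚᵘ.≃-reflexive (cong (λ i → mkℚᵘ i (s + q * suc s)) (sym (ℤP.pos-* p r))))
              (ℚᵘ.≃-sym (toℚᵘ-frac (p * r) (s + q * suc s))))))

⟦⟧-homo-* : ∀ m n → ⟦ m * n ⟧ ≡ ⟦ m ⟧ *ℚ ⟦ n ⟧
⟦⟧-homo-* m n = sym (frac-* m 1 n 1 z<s z<s)

⟦⟧-homo-+ : ∀ m n → ⟦ m + n ⟧ ≡ ⟦ m ⟧ +ℚ ⟦ n ⟧
⟦⟧-homo-+ m n = ℚ.toℚᵘ-injective
  (ℚᵘ.≃-trans (toℚᵘ-frac (m + n) 0)
  (ℚᵘ.≃-trans (ℚᵘ.≃-reflexive (cong (λ i → mkℚᵘ i 0) numerator))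
  (ℚᵘ.≃-sym (ℚᵘ.≃-trans (ℚ.toℚᵘ-homo-+ ⟦ m ⟧ ⟦ n ⟧) (ℚᵘ.+-cong (toℚᵘ-frac m 0) (toℚᵘ-frac n 0))))))
  where
  numerator : ℤ.+ (m + n) ≡ ℤ.+ m ℤ.* ℤ.+ 1 ℤ.+ ℤ.+ n ℤ.* ℤ.+ 1
  numerator = trans (ℤP.pos-+ m n) (sym (cong₂ ℤ._+_ (ℤP.*-identityʳ (ℤ.+ m)) (ℤP.*-identityʳ (ℤ.+ n))))

⟦⟧-homo-*-+ : ∀ w x y → ⟦ w * (x + y) ⟧ ≡ ⟦ w * x ⟧ +ℚ ⟦ w * y ⟧
⟦⟧-homo-*-+ w x y = trans (cong ⟦_⟧ (*-distribˡ-+ w x y)) (⟦⟧-homo-+ (w * x) (w * y))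

⟦*0⟧ : ∀ w {t} → t ≡ 0 → ⟦ w * t ⟧ ≡ 0ℚ
⟦*0⟧ w t≡0 = cong ⟦_⟧ (trans (cong (w *_) t≡0) (*-zeroʳ w))

frac-factor : ∀ p q u v X → q > 0 → u > 0 → v > 0 → p * (u * v) ≡ X * q →
              frac p q ≡ frac 1 u *ℚ (frac 1 v *ℚ ⟦ X ⟧)
frac-factor p q (suc u) (suc v) X q>0 z<s z<s p[uv]≡Xq = begin
  frac p q                                     ≡⟨ frac-cross p q (1 * (1 * X)) (suc u * (suc v * 1)) q>0 z<s cross ⟩
  frac (1 * (1 * X)) (suc u * (suc v * 1))     ≡⟨ frac-* 1 (suc u) (1 * X) (suc v * 1) z<s z<s ⟨
  frac 1 (suc u) *ℚ frac (1 * X) (suc v * 1)  ≡⟨ cong (frac 1 (suc u) *ℚ_) (frac-* 1 (suc v) X 1 z<s z<s) ⟨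
  frac 1 (suc u) *ℚ (frac 1 (suc v) *ℚ ⟦ X ⟧)  ∎
  where
  cross : p * (suc u * (suc v * 1)) ≡ 1 * (1 * X) * q
  cross = trans (cong (λ w → p * (suc u * w)) (*-identityʳ (suc v)))
                (trans p[uv]≡Xq (cong (_* q) (sym (trans (*-identityˡ (1 * X)) (*-identityˡ X)))))

sumFromTo-cong : ∀ hi {f g : ℕ → ℚ} → (∀ j → f (2 + j) ≡ g (2 + j)) → sumFromTo 2 hi f ≡ sumFromTo 2 hi g
sumFromTo-cong 0             f≗g = refl
sumFromTo-cong 1             f≗g = refl
sumFromTo-cong (suc (suc h)) f≗g = cong₂ _+ℚ_ (sumFromTo-cong (suc h) f≗g) (f≗g h)

sumFromTo-+ : ∀ hi (f g : ℕ → ℚ) →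
              sumFromTo 2 hi (λ k → f k +ℚ g k) ≡ sumFromTo 2 hi f +ℚ sumFromTo 2 hi g
sumFromTo-+ 0             f g = refl
sumFromTo-+ 1             f g = refl
sumFromTo-+ (suc (suc h)) f g =
  trans (cong (_+ℚ (f (2 + h) +ℚ g (2 + h))) (sumFromTo-+ (suc h) f g))
        (ℚ+.interchange (sumFromTo 2 (suc h) f) (sumFromTo 2 (suc h) g) (f (2 + h)) (g (2 + h)))

sumFromTo-*ˡ : ∀ hi x (f : ℕ → ℚ) → sumFromTo 2 hi (λ k → x *ℚ f k) ≡ x *ℚ sumFromTo 2 hi f
sumFromTo-*ˡ 0             x f = sym (ℚ.*-zeroʳ x)
sumFromTo-*ˡ 1             x f = sym (ℚ.*-zeroʳ x)
sumFromTo-*ˡ (suc (suc h)) x f =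
  trans (cong (_+ℚ x *ℚ f (2 + h)) (sumFromTo-*ˡ (suc h) x f))
        (sym (ℚ.*-distribˡ-+ x (sumFromTo 2 (suc h) f) (f (2 + h))))

⟦∑<⟧ : ∀ h (f : ℕ → ℕ) → ⟦ ∑< h (λ j → f (2 + j)) ⟧ ≡ sumFromTo 2 (suc h) (λ k → ⟦ f k ⟧)
⟦∑<⟧ zero    f = refl
⟦∑<⟧ (suc h) f = trans (⟦⟧-homo-+ (∑< h (λ j → f (2 + j))) (f (2 + h))) (cong (_+ℚ ⟦ f (2 + h) ⟧) (⟦∑<⟧ h f))

sumFromTo-Pascal : ∀ hi (F : ℕ → ℕ → ℕ → ℚ) → (∀ j → Pascal _+ℚ_ (F (2 + j))) →
                   Pascal _+ℚ_ (λ n a → sumFromTo 2 hi (λ k → F k n a))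
sumFromTo-Pascal hi F F-rec n a =
  trans (sumFromTo-cong hi (λ j → F-rec j n a)) (sumFromTo-+ hi (λ k → F k (suc n) a) (λ k → F k n (suc a)))

ψ-expand : ∀ j x → ψ (2 + j) (suc x) ≡ ⟦ suc x ⟧ +ℚ ⟦ (2 + j) * (1 + j) * ((x + suc j) C (2 + j)) ⟧
ψ-expand j x = begin
  ⟦ suc x ⟧ +ℚ (⟦ 1 + j ⟧ *ℚ (⟦ suc x ⟧ - 1ℚ)) *ℚ ⟦ (suc x + (2 + j) ∸ 2) C (1 + j) ⟧
    ≡⟨ cong₂ (λ u t → ⟦ suc x ⟧ +ℚ (⟦ 1 + j ⟧ *ℚ u) *ℚ ⟦ t C (1 + j) ⟧) predecessor top ⟩
  ⟦ suc x ⟧ +ℚ (⟦ 1 + j ⟧ *ℚ ⟦ x ⟧) *ℚ ⟦ (x + suc j) C (1 + j) ⟧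
    ≡⟨ cong (⟦ suc x ⟧ +ℚ_) (trans (⟦⟧-homo-* ((1 + j) * x) B) (cong (_*ℚ ⟦ B ⟧) (⟦⟧-homo-* (1 + j) x))) ⟨
  ⟦ suc x ⟧ +ℚ ⟦ (1 + j) * x * ((x + suc j) C (1 + j)) ⟧
    ≡⟨ cong (λ t → ⟦ suc x ⟧ +ℚ ⟦ t ⟧) absorb ⟩
  ⟦ suc x ⟧ +ℚ ⟦ (2 + j) * (1 + j) * ((x + suc j) C (2 + j)) ⟧ ∎
  where
  B = (x + suc j) C (1 + j)
  predecessor : ⟦ suc x ⟧ - 1ℚ ≡ ⟦ x ⟧
  predecessor = trans (cong (_- 1ℚ) (⟦⟧-homo-+ 1 x)) (ℚ+⁻.xyx⁻¹≈y 1ℚ ⟦ x ⟧)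
  top : suc x + (2 + j) ∸ 2 ≡ x + suc j
  top = cong (_∸ 1) (+-suc x (suc j))
  absorb : (1 + j) * x * ((x + suc j) C (1 + j)) ≡ (2 + j) * (1 + j) * ((x + suc j) C (2 + j))
  absorb = begin
    (1 + j) * x * ((x + suc j) C (1 + j))      ≡⟨ *-assoc (1 + j) x _ ⟩
    (1 + j) * (x * ((x + suc j) C (1 + j)))    ≡⟨ cong ((1 + j) *_) (n*[n+k]Ck≡[1+k]*[n+k]C[1+k] x (suc j)) ⟩
    (1 + j) * ((2 + j) * ((x + suc j) C (2 + j)))  ≡⟨ ℕ*.x∙yz≈yx∙z (1 + j) (2 + j) _ ⟩
    (2 + j) * (1 + j) * ((x + suc j) C (2 + j))    ∎

stirling-expansion-ℚ : ∀ m x →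
  ⟦ x ^ suc m ⟧ ≡ ⟦ x ⟧ +ℚ sumFromTo 2 (suc m) (λ k → ⟦ k ! * stirling2 (suc m) k * (x C k) ⟧)
stirling-expansion-ℚ m x = begin
  ⟦ x ^ suc m ⟧                                    ≡⟨ cong ⟦_⟧ (stirling-expansion (suc m) x) ⟨
  ⟦ ∑< (2 + m) T ⟧                                 ≡⟨ cong ⟦_⟧ (trans (∑<-suc (suc m) T) (∑<-suc m (λ k → T (suc k)))) ⟩
  ⟦ T 1 + ∑< m (λ j → T (2 + j)) ⟧                 ≡⟨ ⟦⟧-homo-+ (T 1) _ ⟩
  ⟦ T 1 ⟧ +ℚ ⟦ ∑< m (λ j → T (2 + j)) ⟧            ≡⟨ cong₂ _+ℚ_ (cong ⟦_⟧ T1≡x) (⟦∑<⟧ m T) ⟩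
  ⟦ x ⟧ +ℚ sumFromTo 2 (suc m) (λ k → ⟦ T k ⟧)     ∎
  where
  T : ℕ → ℕ
  T k = k ! * stirling2 (suc m) k * (x C k)
  T1≡x : T 1 ≡ x
  T1≡x = trans (cong (λ s → 1 * s * (x C 1)) (S[1+m,1]≡1 m)) (trans (*-identityˡ (x C 1)) (nC1≡n x))

ψ-term : (ℕ → ℚ) → ℕ → ℕ → ℕ → ℚ
ψ-term c k n a = c k *ℚ ⟦ k * (k ∸ 1) * ((k ∸ 2 + n + a) C (a + k)) ⟧

stirling-term : ℕ → ℕ → ℕ → ℕ → ℚ
stirling-term m k n a = ⟦ k ! * stirling2 m k * ((n + a) C (a + k)) ⟧

ψ-sum : ℕ → (ℕ → ℚ) → ℕ → ℕ → ℚ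
ψ-sum m c n a = sumFromTo 2 m (λ k → ψ-term c k n a)

stirling-sum : ℕ → ℕ → ℕ → ℚ
stirling-sum m n a = sumFromTo 2 m (λ k → stirling-term m k n a)

ψ-term-Pascal : ∀ c j → Pascal _+ℚ_ (ψ-term c (2 + j))
ψ-term-Pascal c j n a = begin
  c (2 + j) *ℚ ⟦ w * B (suc n) (suc a) ⟧
    ≡⟨ cong (λ t → c (2 + j) *ℚ ⟦ w * t ⟧) (binomial-Pascal j (2 + j) n a) ⟩
  c (2 + j) *ℚ ⟦ w * (B (suc n) a + B n (suc a)) ⟧
    ≡⟨ cong (c (2 + j) *ℚ_) (⟦⟧-homo-*-+ w (B (suc n) a) (B n (suc a))) ⟩
  c (2 + j) *ℚ (⟦ w * B (suc n) a ⟧ +ℚ ⟦ w * B n (suc a) ⟧)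
    ≡⟨ ℚ.*-distribˡ-+ (c (2 + j)) ⟦ w * B (suc n) a ⟧ ⟦ w * B n (suc a) ⟧ ⟩
  c (2 + j) *ℚ ⟦ w * B (suc n) a ⟧ +ℚ c (2 + j) *ℚ ⟦ w * B n (suc a) ⟧ ∎
  where
  w = (2 + j) * (1 + j)
  B : ℕ → ℕ → ℕ
  B n a = (j + n + a) C (a + (2 + j))

stirling-term-Pascal : ∀ m j → Pascal _+ℚ_ (stirling-term m (2 + j))
stirling-term-Pascal m j n a =
  trans (cong (λ t → ⟦ w * t ⟧) (binomial-Pascal 0 (2 + j) n a))
        (⟦⟧-homo-*-+ w ((suc n + a) C (a + (2 + j))) ((n + suc a) C (suc a + (2 + j))))
  where
  w = (2 + j) ! * stirling2 m (2 + j)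

ψ-term-vanishes : ∀ c j a → ψ-term c (2 + j) 0 a ≡ 0ℚ
ψ-term-vanishes c j a =
  trans (cong (c (2 + j) *ℚ_) (⟦*0⟧ ((2 + j) * (1 + j)) (k>n⇒nCk≡0 top<bottom))) (ℚ.*-zeroʳ (c (2 + j)))
  where
  top<bottom : j + 0 + a < a + (2 + j)
  top<bottom = subst (_< a + (2 + j)) commute (+-monoʳ-< a (m<n+m j z<s))
    where
    commute : a + j ≡ j + 0 + a
    commute = solve (j ∷ a ∷ [])

stirling-term-vanishes : ∀ m j a → stirling-term m (2 + j) 0 a ≡ 0ℚ
stirling-term-vanishes m j a = ⟦*0⟧ ((2 + j) ! * stirling2 m (2 + j)) (k>n⇒nCk≡0 (m<m+n a z<s))

coefficients-sum≡1 : ∀ m c → (∀ x → ⟦ x ^ m ⟧ ≡ sumFromTo 2 m (λ k → c k *ℚ ψ k x)) → sumFromTo 2 m c ≡ 1ℚ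
coefficients-sum≡1 m c hyp = begin
  sumFromTo 2 m c                     ≡⟨ sumFromTo-cong m c-ψ-at-1 ⟨
  sumFromTo 2 m (λ k → c k *ℚ ψ k 1)  ≡⟨ hyp 1 ⟨
  ⟦ 1 ^ m ⟧                           ≡⟨ cong ⟦_⟧ (^-zeroˡ m) ⟩
  1ℚ                                  ∎
  where
  ψ-at-1 : ∀ j → ψ (2 + j) 1 ≡ 1ℚ
  ψ-at-1 j = trans (ψ-expand j 0)
    (trans (cong (1ℚ +ℚ_) (⟦*0⟧ ((2 + j) * (1 + j)) (k>n⇒nCk≡0 (n<1+n (suc j))))) (ℚ.+-identityʳ 1ℚ))
  c-ψ-at-1 : ∀ j → c (2 + j) *ℚ ψ (2 + j) 1 ≡ c (2 + j)
  c-ψ-at-1 j = trans (cong (c (2 + j) *ℚ_) (ψ-at-1 j)) (ℚ.*-identityʳ (c (2 + j)))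

ψ-sum-base : ∀ m c → (∀ x → ⟦ x ^ m ⟧ ≡ sumFromTo 2 m (λ k → c k *ℚ ψ k x)) →
             ∀ x → ⟦ suc x ^ m ⟧ ≡ ⟦ suc x ⟧ +ℚ ψ-sum m c (suc x) 0
ψ-sum-base m c hyp x = begin
  ⟦ suc x ^ m ⟧
    ≡⟨ hyp (suc x) ⟩
  sumFromTo 2 m (λ k → c k *ℚ ψ k (suc x))
    ≡⟨ sumFromTo-cong m c-ψ-expand ⟩
  sumFromTo 2 m (λ k → ⟦ suc x ⟧ *ℚ c k +ℚ ψ-term c k (suc x) 0)
    ≡⟨ sumFromTo-+ m (λ k → ⟦ suc x ⟧ *ℚ c k) (λ k → ψ-term c k (suc x) 0) ⟩
  sumFromTo 2 m (λ k → ⟦ suc x ⟧ *ℚ c k) +ℚ ψ-sum m c (suc x) 0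
    ≡⟨ cong (_+ℚ ψ-sum m c (suc x) 0) (sumFromTo-*ˡ m ⟦ suc x ⟧ c) ⟩
  ⟦ suc x ⟧ *ℚ sumFromTo 2 m c +ℚ ψ-sum m c (suc x) 0
    ≡⟨ cong (λ s → ⟦ suc x ⟧ *ℚ s +ℚ ψ-sum m c (suc x) 0) (coefficients-sum≡1 m c hyp) ⟩
  ⟦ suc x ⟧ *ℚ 1ℚ +ℚ ψ-sum m c (suc x) 0
    ≡⟨ cong (_+ℚ ψ-sum m c (suc x) 0) (ℚ.*-identityʳ ⟦ suc x ⟧) ⟩
  ⟦ suc x ⟧ +ℚ ψ-sum m c (suc x) 0 ∎
  where
  c-ψ-expand : ∀ j → c (2 + j) *ℚ ψ (2 + j) (suc x) ≡ ⟦ suc x ⟧ *ℚ c (2 + j) +ℚ ψ-term c (2 + j) (suc x) 0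
  c-ψ-expand j = begin
    c (2 + j) *ℚ ψ (2 + j) (suc x)
      ≡⟨ cong (c (2 + j) *ℚ_) (ψ-expand j x) ⟩
    c (2 + j) *ℚ (⟦ suc x ⟧ +ℚ ⟦ w * ((x + suc j) C (2 + j)) ⟧)
      ≡⟨ ℚ.*-distribˡ-+ (c (2 + j)) ⟦ suc x ⟧ ⟦ w * ((x + suc j) C (2 + j)) ⟧ ⟩
    c (2 + j) *ℚ ⟦ suc x ⟧ +ℚ c (2 + j) *ℚ ⟦ w * ((x + suc j) C (2 + j)) ⟧
      ≡⟨ cong₂ _+ℚ_ (ℚ.*-comm (c (2 + j)) ⟦ suc x ⟧) (cong (λ t → c (2 + j) *ℚ ⟦ w * (t C (2 + j)) ⟧) top) ⟩
    ⟦ suc x ⟧ *ℚ c (2 + j) +ℚ ψ-term c (2 + j) (suc x) 0 ∎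
    where
    w = (2 + j) * (1 + j)
    top : x + suc j ≡ j + suc x + 0
    top = solve (x ∷ j ∷ [])

stirling-sum-base : ∀ m x → ⟦ x ^ suc m ⟧ ≡ ⟦ x ⟧ +ℚ stirling-sum (suc m) x 0
stirling-sum-base m x = trans (stirling-expansion-ℚ m x) (cong (⟦ x ⟧ +ℚ_) (sumFromTo-cong (suc m) λ j →
  cong (λ t → ⟦ (2 + j) ! * stirling2 (suc m) (2 + j) * (t C (2 + j)) ⟧) (sym (+-identityʳ x))))

ψ-sum≡stirling-sum : ∀ m c → (∀ x → ⟦ x ^ suc m ⟧ ≡ sumFromTo 2 (suc m) (λ k → c k *ℚ ψ k x)) →
                     ∀ n a → ψ-sum (suc m) c n a ≡ stirling-sum (suc m) n a
ψ-sum≡stirling-sum m c hyp = Pascal-unique _+ℚ_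
  (sumFromTo-Pascal (suc m) (ψ-term c) (ψ-term-Pascal c))
  (sumFromTo-Pascal (suc m) (stirling-term (suc m)) (stirling-term-Pascal (suc m)))
  (λ a → sumFromTo-cong (suc m) λ j → trans (ψ-term-vanishes c j a) (sym (stirling-term-vanishes (suc m) j a)))
  (λ x → ℚ+⁻.∙-cancelˡ ⟦ suc x ⟧ _ _
           (trans (sym (ψ-sum-base (suc m) c hyp x)) (stirling-sum-base m (suc x))))

binomial-quotient : ∀ N a j →
  frac ((N + a + (2 + j)) C j) ((a + (2 + j)) C (2 + j))
    ≡ frac 1 ((2 + N) * (1 + N)) *ℚ (frac 1 ((2 + N + a) C a) *ℚ ⟦ (2 + j) * (1 + j) * ((j + (2 + N) + a) C (a + (2 + j))) ⟧)
binomial-quotient N a j = frac-factor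
  ((N + a + (2 + j)) C j) ((a + (2 + j)) C (2 + j)) ((2 + N) * (1 + N)) ((2 + N + a) C a)
  ((2 + j) * (1 + j) * ((j + (2 + N) + a) C (a + (2 + j))))
  (k≤n⇒nCk>0 (m≤n+m (2 + j) a)) z<s (k≤n⇒nCk>0 (m≤n+m a (2 + N))) (binomial-identity N a j)

fact7 : (m : ℕ) → 2 ≤ m → (c : ℕ → ℚ)
      → (∀ (x : ℕ) → ⟦ x ^ m ⟧ ≡ sumFromTo 2 m (λ k → c k *ℚ ψ k x))
      → (a n : ℕ) → 2 ≤ n
      → sumFromTo 2 m (λ k → c k *ℚ frac ((n + a + k ∸ 2) C (k ∸ 2)) ((a + k) C k))
        ≡ frac 1 (n * (n ∸ 1)) *ℚ (frac 1 ((n + a) C a)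
            *ℚ sumFromTo 2 m (λ k → ⟦ k ! * stirling2 m k * ((n + a) C (a + k)) ⟧))
fact7 m@(suc (suc L)) (s≤s (s≤s z≤n)) c hyp a n@(suc (suc N)) (s≤s (s≤s z≤n)) = begin
  sumFromTo 2 m (λ k → c k *ℚ frac ((n + a + k ∸ 2) C (k ∸ 2)) ((a + k) C k))
    ≡⟨ sumFromTo-cong m rescale ⟩
  sumFromTo 2 m (λ k → I *ℚ (J *ℚ ψ-term c k n a))
    ≡⟨ sumFromTo-*ˡ m I (λ k → J *ℚ ψ-term c k n a) ⟩
  I *ℚ sumFromTo 2 m (λ k → J *ℚ ψ-term c k n a)
    ≡⟨ cong (I *ℚ_) (sumFromTo-*ˡ m J (λ k → ψ-term c k n a)) ⟩
  I *ℚ (J *ℚ ψ-sum m c n a)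
    ≡⟨ cong (λ s → I *ℚ (J *ℚ s)) (ψ-sum≡stirling-sum (suc L) c hyp n a) ⟩
  I *ℚ (J *ℚ stirling-sum m n a) ∎
  where
  I = frac 1 (n * (n ∸ 1))
  J = frac 1 ((n + a) C a)
  rescale : ∀ j → c (2 + j) *ℚ frac ((n + a + (2 + j) ∸ 2) C j) ((a + (2 + j)) C (2 + j))
                   ≡ I *ℚ (J *ℚ ψ-term c (2 + j) n a)
  rescale j = trans (cong (c (2 + j) *ℚ_) (binomial-quotient N a j))
                    (trans (ℚ*.x∙yz≈y∙xz (c (2 + j)) I _) (cong (I *ℚ_) (ℚ*.x∙yz≈y∙xz (c (2 + j)) J _)))
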